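{- Let $R$ be a finite commutative co-local ring with identity which is not a field, and let $N$ be the non-trivial ideal contained in all proper non-trivial ideals of $R$. Then $$\gamma^o(\Gamma(R)) \geq \left\lceil \frac{|N^*|}{2} \right\rceil,$$ where $N^*=N\setminus\{0\}$. Furthermore, this bound is sharp: equality holds for $R=\mathbb{Z}_9$.
   Context: A commutative ring $R$ is co-local if it contains a non-trivial ideal that is contained in every non-trivial proper ideal of $R$. $Z(R)^*$ denotes the set of nonzero zero-divisors of $R$. The zero-divisor graph $\Gamma(R)$ is the simple graph with vertex set $Z(R)^*$, in which distinct $u,v$ are adjacent if and only if $uv=0$. For a simple graph $\Gamma=(V,E)$, a set $S\subseteq V$ and a vertex $v$, let $\delta_S(v)$ be the number of neighbors of $v$ in $S$ and $\overline{S}=V\setminus S$. A nonempty set $S\subseteq V$ is a global offensive alliance if $\delta_S(v)\geq \delta_{\overline{S}}(v)+1$ for every $v\in\overline{S}$. $\gamma^o(\Gamma)$ is the minimum cardinality of a global offensive alliance of $\Gamma$. -}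

module Defs where

open import Level using (Level; _⊔_) renaming (suc to lsuc)
open import Data.Bool using (Bool; true; false; not; _∧_; _∨_; if_then_else_)
open import Data.Nat using (ℕ; zero; suc; _≤_)
open import Data.Nat as ℕ using ()
open import Data.Nat.Properties as ℕP using ()
open import Data.Nat.DivMod using (_%_; %-distribˡ-+; %-distribˡ-*; m*n%n≡0; m%n<n; m%n%n≡m%n; m<n⇒m%n≡m)
open import Data.Fin using (Fin; toℕ; fromℕ<)
open import Data.Fin.Properties using (toℕ-injective; toℕ<n; toℕ-fromℕ<)
import Data.Fin as Fin
open import Data.Product using (Σ; ∃; ∃-syntax; _×_; _,_)
open import Relation.Nullary using (¬_)
open import Relation.Nullary.Decidable using (⌊_⌋)
open import Relation.Binary using (Decidable)
open import Relation.Binary.PropositionalEquality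
  using (_≡_; refl; sym; trans; cong; cong₂; isEquivalence)
open import Algebra.Bundles using (CommutativeRing)
open import Algebra.Structures using (IsCommutativeRing)

record FiniteCommRing (c ℓ : Level) : Set (lsuc (c ⊔ ℓ)) where
  field
    commRing : CommutativeRing c ℓ
  open CommutativeRing commRing public
  field
    _≈?_      : Decidable _≈_
    size      : ℕ
    elem      : Fin size → Carrier
    elem-surj : ∀ x → ∃[ i ] (elem i ≈ x)
    elem-inj  : ∀ i j → elem i ≈ elem j → i ≡ j

count : ∀ {m} → (Fin m → Bool) → ℕ
count {zero}  P = 0
count {suc m} P = (if P Fin.zero then 1 else 0) ℕ.+ count (λ i → P (Fin.suc i))

anyFin : ∀ {m} → (Fin m → Bool) → Bool
anyFin {zero}  P = false
anyFin {suc m} P = P Fin.zero ∨ anyFin (λ i → P (Fin.suc i))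

module _ {c ℓ : Level} (R : FiniteCommRing c ℓ) where
  open FiniteCommRing R

  isZeroᵇ : Carrier → Bool
  isZeroᵇ x = ⌊ x ≈? 0# ⌋

  IsField : Set (c ⊔ ℓ)
  IsField = (¬ 0# ≈ 1#) × (∀ x → ¬ x ≈ 0# → ∃[ y ] (x * y ≈ 1#))

  record Ideal : Set (c ⊔ ℓ) where
    field
      mem      : Carrier → Bool
      mem-resp : ∀ {x y} → x ≈ y → mem x ≡ mem y
      mem-0    : mem 0# ≡ true
      mem-+    : ∀ x y → mem x ≡ true → mem y ≡ true → mem (x + y) ≡ true
      mem-neg  : ∀ x → mem x ≡ true → mem (- x) ≡ true
      mem-*    : ∀ r x → mem x ≡ true → mem (r * x) ≡ true
  open Ideal public

  NonTrivial : Ideal → Set (c ⊔ ℓ)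
  NonTrivial I = ∃[ x ] (mem I x ≡ true × ¬ x ≈ 0#)

  Proper : Ideal → Set c
  Proper I = ∃[ x ] (mem I x ≡ false)

  _⊆ᴵ_ : Ideal → Ideal → Set c
  I ⊆ᴵ J = ∀ x → mem I x ≡ true → mem J x ≡ true

  IsCoLocalIdeal : Ideal → Set (c ⊔ ℓ)
  IsCoLocalIdeal N = NonTrivial N × (∀ I → NonTrivial I → Proper I → N ⊆ᴵ I)

  IsCoLocal : Set (c ⊔ ℓ)
  IsCoLocal = ∃[ N ] IsCoLocalIdeal N

  cardNStar : Ideal → ℕ
  cardNStar N = count (λ i → mem N (elem i) ∧ not (isZeroᵇ (elem i)))

  isVertex : Fin size → Bool
  isVertex i = not (isZeroᵇ (elem i))
             ∧ anyFin (λ j → not (isZeroᵇ (elem j)) ∧ isZeroᵇ (elem i * elem j))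

  adj : Fin size → Fin size → Bool
  adj i j = not ⌊ i Fin.≟ j ⌋ ∧ isVertex i ∧ isVertex j ∧ isZeroᵇ (elem i * elem j)

  VSet : Set
  VSet = Fin size → Bool

  card : VSet → ℕ
  card S = count S

  δ-in : VSet → Fin size → ℕ
  δ-in S v = count (λ u → isVertex u ∧ S u ∧ adj v u)

  δ-out : VSet → Fin size → ℕ
  δ-out S v = count (λ u → isVertex u ∧ not (S u) ∧ adj v u)

  IsGOA : VSet → Set
  IsGOA S = (∀ i → S i ≡ true → isVertex i ≡ true)
          × (∃[ i ] S i ≡ true)
          × (∀ v → isVertex v ≡ true → S v ≡ false → δ-out S v ℕ.+ 1 ≤ δ-in S v)

  IsGammaO : ℕ → Set
  IsGammaO k = (∃[ S ] (IsGOA S × card S ≡ k)) × (∀ S → IsGOA S → k ≤ card S)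

private
  _≈₉_ : ℕ → ℕ → Set
  x ≈₉ y = x % 9 ≡ y % 9

  ≡⇒≈₉ : ∀ {x y} → x ≡ y → x ≈₉ y
  ≡⇒≈₉ = cong (_% 9)

  +-cong₉ : ∀ {a b c d} → a ≈₉ b → c ≈₉ d → (a ℕ.+ c) ≈₉ (b ℕ.+ d)
  +-cong₉ {a} {b} {c} {d} p q =
    trans (%-distribˡ-+ a c 9) (trans (cong₂ (λ u v → (u ℕ.+ v) % 9) p q) (sym (%-distribˡ-+ b d 9)))

  *-cong₉ : ∀ {a b c d} → a ≈₉ b → c ≈₉ d → (a ℕ.* c) ≈₉ (b ℕ.* d)
  *-cong₉ {a} {b} {c} {d} p q =
    trans (%-distribˡ-* a c 9) (trans (cong₂ (λ u v → (u ℕ.* v) % 9) p q) (sym (%-distribˡ-* b d 9)))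

  neg₉ : ℕ → ℕ
  neg₉ x = 8 ℕ.* x

  invˡ₉ : ∀ x → (neg₉ x ℕ.+ x) ≈₉ 0
  invˡ₉ x = trans (cong (_% 9) (trans (ℕP.+-comm (8 ℕ.* x) x) (ℕP.*-comm 9 x))) (m*n%n≡0 x 9)

  invʳ₉ : ∀ x → (x ℕ.+ neg₉ x) ≈₉ 0
  invʳ₉ x = trans (cong (_% 9) (ℕP.+-comm x (8 ℕ.* x))) (invˡ₉ x)

  isCR₉ : IsCommutativeRing _≈₉_ ℕ._+_ ℕ._*_ neg₉ 0 1
  isCR₉ = record
    { isRing = record
      { +-isAbelianGroup = record
        { isGroup = record
          { isMonoid = record
            { isSemigroup = record
              { isMagma = record
                { isEquivalence = record { refl = refl ; sym = λ {x} {y} → sym {x = x % 9} {y % 9} ; trans = λ {x} {y} {z} → trans {i = x % 9} {y % 9} {z % 9} }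
                ; ∙-cong = λ {a} {b} {c} {d} → +-cong₉ {a} {b} {c} {d} }
              ; assoc = λ x y z → ≡⇒≈₉ (ℕP.+-assoc x y z) }
            ; identity = (λ x → refl) , (λ x → ≡⇒≈₉ (ℕP.+-identityʳ x)) }
          ; inverse = invˡ₉ , invʳ₉
          ; ⁻¹-cong = λ {x} {y} p → *-cong₉ {8} {8} {x} {y} refl p }
        ; comm = λ x y → ≡⇒≈₉ (ℕP.+-comm x y) }
      ; *-cong = λ {a} {b} {c} {d} → *-cong₉ {a} {b} {c} {d}
      ; *-assoc = λ x y z → ≡⇒≈₉ (ℕP.*-assoc x y z)
      ; *-identity = (λ x → ≡⇒≈₉ (ℕP.*-identityˡ x)) , (λ x → ≡⇒≈₉ (ℕP.*-identityʳ x))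
      ; distrib = (λ x y z → ≡⇒≈₉ (ℕP.*-distribˡ-+ x y z)) , (λ x y z → ≡⇒≈₉ (ℕP.*-distribʳ-+ x y z)) }
    ; *-comm = λ x y → ≡⇒≈₉ (ℕP.*-comm x y) }

  surj₉ : ∀ x → ∃[ i ] (toℕ {9} i ≈₉ x)
  surj₉ x = fromℕ< (m%n<n x 9) ,
    trans (cong (_% 9) (toℕ-fromℕ< (m%n<n x 9))) (m%n%n≡m%n x 9)

  inj₉ : ∀ (i j : Fin 9) → toℕ i ≈₉ toℕ j → i ≡ j
  inj₉ i j p = toℕ-injective
    (trans (sym (m<n⇒m%n≡m (toℕ<n i))) (trans p (m<n⇒m%n≡m (toℕ<n j))))

ℤ₉ : FiniteCommRing Level.zero Level.zero
ℤ₉ = record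
  { commRing = record { isCommutativeRing = isCR₉ }
  ; _≈?_ = λ x y → x % 9 ℕP.≟ y % 9
  ; size = 9
  ; elem = toℕ
  ; elem-surj = surj₉
  ; elem-inj = inj₉
  }

module Submission where

-- The annihilator of a vertex y of Γ(R) is a non-trivial proper ideal, so it contains N: every
-- element of N kills every vertex. Hence N* consists of vertices and is a clique.
-- If v ∈ N* lies outside an offensive alliance S, every other element of N* ∖ S is a neighbour of
-- v outside S, so |N* ∖ S| - 1 ≤ δ_S̄(v) < δ_S(v) ≤ |S|; with |N* ∩ S| ≤ |S| this gives
-- |N*| ≤ 2|S|. In ℤ₉ the co-local ideal is 3ℤ₉, and {3} is an alliance of size 1 = ⌈2/2⌉.

open import Defs
open import Level using (Level)
open import Data.Bool using (Bool; true; false; not; _∧_; if_then_else_)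
import Data.Bool as Bool
open import Data.Bool.Properties using (∨-zeroʳ; not-injective; not-¬; ⇔→≡)
open import Data.Nat using (ℕ; zero; suc; _≤_; _≤?_; ⌈_/2⌉; z≤n; s≤s)
import Data.Nat as ℕ
open import Data.Nat.Properties
  using (module ≤-Reasoning; ≤-trans; ≤-reflexive; m≤n+m; +-suc; +-mono-≤; *-zeroʳ;
         ⌈n/2⌉-mono; n≡⌈n+n/2⌉)
import Data.Nat.Properties as ℕₚ
open import Data.Nat.DivMod using (%-distribˡ-+; %-distribˡ-*; m∣n⇒o%n%m≡o%m)
open import Data.Nat.Divisibility using (divides)
open import Data.Fin using (Fin; toℕ; #_)
import Data.Fin as Fin
open import Data.Fin.Properties using (all?; any?; suc-injective)
open import Data.Product using (_×_; ∃; ∃-syntax; _,_; proj₁; proj₂)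
open import Data.Sum using (_⊎_; inj₁; inj₂)
open import Data.Empty using (⊥-elim)
open import Function using (_∘_; mk⇔)
open import Relation.Nullary using (¬_; Dec; yes; no; ¬?)
open import Relation.Nullary.Decidable using (⌊_⌋; from-yes; _→-dec_; _×-dec_)
open import Relation.Binary.PropositionalEquality
  using (_≡_; _≢_; refl; sym; trans; cong; cong₂; subst; module ≡-Reasoning)

∧-elimˡ : ∀ {a b} → a ∧ b ≡ true → a ≡ true
∧-elimˡ {true} _ = refl

∧-elimʳ : ∀ {a b} → a ∧ b ≡ true → b ≡ true
∧-elimʳ {true} b≡true = b≡true

∧-intro : ∀ {a b} → a ≡ true → b ≡ true → a ∧ b ≡ true
∧-intro refl refl = refl

⌊⌋≡true⇒ : ∀ {p} {P : Set p} (p? : Dec P) → ⌊ p? ⌋ ≡ true → P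
⌊⌋≡true⇒ (yes p) _ = p

⌊⌋≡true : ∀ {p} {P : Set p} (p? : Dec P) → P → ⌊ p? ⌋ ≡ true
⌊⌋≡true (yes _) _  = refl
⌊⌋≡true (no ¬p) p = ⊥-elim (¬p p)

⌊⌋≡false : ∀ {p} {P : Set p} (p? : Dec P) → ¬ P → ⌊ p? ⌋ ≡ false
⌊⌋≡false (yes p) ¬p = ⊥-elim (¬p p)
⌊⌋≡false (no _)  _  = refl

indicator≤1 : (b : Bool) → (if b then 1 else 0) ≤ 1
indicator≤1 true  = s≤s z≤n
indicator≤1 false = z≤n

count-cong : ∀ {m} {P Q : Fin m → Bool} → (∀ i → P i ≡ Q i) → count P ≡ count Q
count-cong {zero}  _   = refl
count-cong {suc m} P≗Q rewrite P≗Q Fin.zero = cong (_ ℕ.+_) (count-cong (P≗Q ∘ Fin.suc))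

count-mono : ∀ {m} {P Q : Fin m → Bool} → (∀ i → P i ≡ true → Q i ≡ true) → count P ≤ count Q
count-mono {zero}          _   = z≤n
count-mono {suc m} {P} {Q} P⊆Q with P Fin.zero in P₀
... | true  rewrite P⊆Q Fin.zero P₀ = s≤s (count-mono (P⊆Q ∘ Fin.suc))
... | false = ≤-trans (count-mono (P⊆Q ∘ Fin.suc)) (m≤n+m _ _)

count-partition : ∀ {m} (P Q : Fin m → Bool) →
  count P ≡ count (λ i → P i ∧ Q i) ℕ.+ count (λ i → P i ∧ not (Q i))
count-partition {zero}  P Q = refl
count-partition {suc m} P Q with P Fin.zero | Q Fin.zero
... | true  | true  = cong suc (count-partition (P ∘ Fin.suc) (Q ∘ Fin.suc))
... | true  | false =
  trans (cong suc (count-partition (P ∘ Fin.suc) (Q ∘ Fin.suc))) (sym (+-suc _ _))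
... | false | _     = count-partition (P ∘ Fin.suc) (Q ∘ Fin.suc)

count-witness≥1 : ∀ {m} (P : Fin m → Bool) i → P i ≡ true → 1 ≤ count P
count-witness≥1 P Fin.zero    Pi rewrite Pi = s≤s z≤n
count-witness≥1 P (Fin.suc i) Pi = ≤-trans (count-witness≥1 (P ∘ Fin.suc) i Pi) (m≤n+m _ _)

count≡0⊎witness : ∀ {m} (P : Fin m → Bool) → count P ≡ 0 ⊎ ∃[ i ] P i ≡ true
count≡0⊎witness {zero}  P = inj₁ refl
count≡0⊎witness {suc m} P with P Fin.zero in P₀ | count≡0⊎witness (P ∘ Fin.suc)
... | true  | _            = inj₂ (Fin.zero , P₀)
... | false | inj₁ none    = inj₁ none
... | false | inj₂ (i , p) = inj₂ (Fin.suc i , p)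

count-except : ∀ {m} (P Q : Fin m → Bool) (v : Fin m) →
  (∀ i → P i ≡ true → i ≢ v → Q i ≡ true) → count P ≤ suc (count Q)
count-except {suc m} P Q Fin.zero P⊆Q =
  ≤-trans (+-mono-≤ (indicator≤1 (P Fin.zero)) (count-mono (λ i Pi → P⊆Q (Fin.suc i) Pi λ ())))
          (s≤s (m≤n+m _ _))
count-except {suc m} P Q (Fin.suc v) P⊆Q
  with P Fin.zero in P₀
     | count-except (P ∘ Fin.suc) (Q ∘ Fin.suc) v
         (λ i Pi i≢v → P⊆Q (Fin.suc i) Pi (i≢v ∘ suc-injective))
... | true  | tail rewrite P⊆Q Fin.zero P₀ (λ ()) = s≤s tail
... | false | tail = ≤-trans tail (s≤s (m≤n+m _ _))

anyFin-witness : ∀ {m} (P : Fin m → Bool) → anyFin P ≡ true → ∃[ i ] P i ≡ true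
anyFin-witness {suc m} P any with P Fin.zero in P₀
... | true  = Fin.zero , P₀
... | false with anyFin-witness (P ∘ Fin.suc) any
...   | i , Pi = Fin.suc i , Pi

anyFin-intro : ∀ {m} (P : Fin m → Bool) i → P i ≡ true → anyFin P ≡ true
anyFin-intro P Fin.zero    Pi rewrite Pi = refl
anyFin-intro P (Fin.suc i) Pi rewrite anyFin-intro (P ∘ Fin.suc) i Pi = ∨-zeroʳ (P Fin.zero)

⌈/2⌉≤ : ∀ {a s} → a ≤ s ℕ.+ s → ⌈ a /2⌉ ≤ s
⌈/2⌉≤ {s = s} a≤2s = ≤-trans (⌈n/2⌉-mono a≤2s) (≤-reflexive (sym (n≡⌈n+n/2⌉ s)))

module ZeroDivisorGraph {c ℓ : Level} (R : FiniteCommRing c ℓ) where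
  open FiniteCommRing R hiding (refl) renaming (sym to ≈-sym; trans to ≈-trans)
  open import Algebra.Properties.Ring ring using (-‿distribˡ-*; -0#≈0#)

  isZeroᵇ⇒≈0 : ∀ {a} → isZeroᵇ R a ≡ true → a ≈ 0#
  isZeroᵇ⇒≈0 {a} = ⌊⌋≡true⇒ (a ≈? 0#)

  ≈0⇒isZeroᵇ : ∀ {a} → a ≈ 0# → isZeroᵇ R a ≡ true
  ≈0⇒isZeroᵇ {a} = ⌊⌋≡true (a ≈? 0#)

  ≉0⇒isZeroᵇ≡false : ∀ {a} → ¬ a ≈ 0# → isZeroᵇ R a ≡ false
  ≉0⇒isZeroᵇ≡false {a} = ⌊⌋≡false (a ≈? 0#)

  ≉0⇒not-isZeroᵇ : ∀ {a} → ¬ a ≈ 0# → not (isZeroᵇ R a) ≡ true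
  ≉0⇒not-isZeroᵇ = cong not ∘ ≉0⇒isZeroᵇ≡false

  not-isZeroᵇ⇒≉0 : ∀ {a} → not (isZeroᵇ R a) ≡ true → ¬ a ≈ 0#
  not-isZeroᵇ⇒≉0 a≉0 a≈0 = not-¬ (≈0⇒isZeroᵇ a≈0) (not-injective a≉0)

  isZeroᵇ-resp : ∀ {a b} → a ≈ b → isZeroᵇ R a ≡ isZeroᵇ R b
  isZeroᵇ-resp a≈b = ⇔→≡ (mk⇔ (λ a≈0 → ≈0⇒isZeroᵇ (≈-trans (≈-sym a≈b) (isZeroᵇ⇒≈0 a≈0)))
                              (λ b≈0 → ≈0⇒isZeroᵇ (≈-trans a≈b (isZeroᵇ⇒≈0 b≈0))))

  annihilator : Carrier → Ideal R
  annihilator y = record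
    { mem      = λ r → isZeroᵇ R (r * y)
    ; mem-resp = λ r≈s → isZeroᵇ-resp (*-congʳ r≈s)
    ; mem-0    = ≈0⇒isZeroᵇ (zeroˡ y)
    ; mem-+    = λ a b ay≈0 by≈0 → ≈0⇒isZeroᵇ (begin
        (a + b) * y    ≈⟨ distribʳ y a b ⟩
        a * y + b * y  ≈⟨ +-cong (isZeroᵇ⇒≈0 ay≈0) (isZeroᵇ⇒≈0 by≈0) ⟩
        0# + 0#        ≈⟨ +-identityˡ 0# ⟩
        0#             ∎)
    ; mem-neg  = λ a ay≈0 → ≈0⇒isZeroᵇ (begin
        - a * y        ≈⟨ -‿distribˡ-* a y ⟨
        - (a * y)      ≈⟨ -‿cong (isZeroᵇ⇒≈0 ay≈0) ⟩
        - 0#           ≈⟨ -0#≈0# ⟩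
        0#             ∎)
    ; mem-*    = λ r a ay≈0 → ≈0⇒isZeroᵇ (begin
        r * a * y      ≈⟨ *-assoc r a y ⟩
        r * (a * y)    ≈⟨ *-congˡ (isZeroᵇ⇒≈0 ay≈0) ⟩
        r * 0#         ≈⟨ zeroʳ r ⟩
        0#             ∎)
    }
    where open import Relation.Binary.Reasoning.Setoid setoid

  proper-ideal⇒non-unit : ∀ {I x} → Proper R I → mem I x ≡ true → ¬ (∃[ y ] x * y ≈ 1#)
  proper-ideal⇒non-unit {I} {x} (r , r∉I) x∈I (y , xy≈1) = not-¬ r∈I r∉I
    where
    1∈I : mem I 1# ≡ true
    1∈I = trans (mem-resp I (≈-sym (≈-trans (*-comm y x) xy≈1))) (mem-* I y x x∈I)
    r∈I : mem I r ≡ true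
    r∈I = trans (mem-resp I (≈-sym (*-identityʳ r))) (mem-* I r 1# 1∈I)

  vertex-nonzero : ∀ {v} → isVertex R v ≡ true → ¬ elem v ≈ 0#
  vertex-nonzero = not-isZeroᵇ⇒≉0 ∘ ∧-elimˡ

  vertex-annihilated : ∀ {v} → isVertex R v ≡ true → ∃[ j ] (¬ elem j ≈ 0# × elem v * elem j ≈ 0#)
  vertex-annihilated v-vertex with anyFin-witness _ (∧-elimʳ v-vertex)
  ... | j , vj≈0 = j , not-isZeroᵇ⇒≉0 (∧-elimˡ vj≈0) , isZeroᵇ⇒≈0 (∧-elimʳ vj≈0)

  zero-divisor⇒vertex : ∀ {u w} → ¬ elem u ≈ 0# → ¬ elem w ≈ 0# → elem u * elem w ≈ 0# →
    isVertex R u ≡ true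
  zero-divisor⇒vertex {u} {w} u≉0 w≉0 uw≈0 =
    ∧-intro (≉0⇒not-isZeroᵇ u≉0) (anyFin-intro _ w (∧-intro (≉0⇒not-isZeroᵇ w≉0) (≈0⇒isZeroᵇ uw≈0)))

  annihilator-nonTrivial : ∀ {v} → isVertex R v ≡ true → NonTrivial R (annihilator (elem v))
  annihilator-nonTrivial v-vertex with vertex-annihilated v-vertex
  ... | j , j≉0 , vj≈0 = elem j , ≈0⇒isZeroᵇ (≈-trans (*-comm _ _) vj≈0) , j≉0

  annihilator-proper : ∀ {v} → isVertex R v ≡ true → Proper R (annihilator (elem v))
  annihilator-proper {v} v-vertex =
    1# , trans (isZeroᵇ-resp (*-identityˡ (elem v))) (≉0⇒isZeroᵇ≡false (vertex-nonzero v-vertex))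

  isGOA? : (S : VSet R) → Dec (IsGOA R S)
  isGOA? S = all? (λ i → (S i Bool.≟ true) →-dec (isVertex R i Bool.≟ true))
       ×-dec any? (λ i → S i Bool.≟ true)
       ×-dec all? (λ v → (isVertex R v Bool.≟ true) →-dec (S v Bool.≟ false)
                           →-dec (δ-out R S v ℕ.+ 1 ≤? δ-in R S v))

  module _ {N : Ideal R} (N-coLocal : IsCoLocalIdeal R N) where

    coLocal-annihilates-vertex : ∀ {x v} → mem N x ≡ true → isVertex R v ≡ true → x * elem v ≈ 0#
    coLocal-annihilates-vertex {x} {v} x∈N v-vertex = isZeroᵇ⇒≈0
      (proj₂ N-coLocal (annihilator (elem v))
        (annihilator-nonTrivial v-vertex) (annihilator-proper v-vertex) x x∈N)

    N* : VSet R
    N* u = mem N (elem u) ∧ not (isZeroᵇ R (elem u))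

    N*-vertex : ∀ {w u} → isVertex R w ≡ true → N* u ≡ true → isVertex R u ≡ true
    N*-vertex w-vertex u∈N* =
      zero-divisor⇒vertex (not-isZeroᵇ⇒≉0 (∧-elimʳ u∈N*)) (vertex-nonzero w-vertex)
        (coLocal-annihilates-vertex (∧-elimˡ u∈N*) w-vertex)

    N*-clique : ∀ {w u v} → isVertex R w ≡ true → N* u ≡ true → N* v ≡ true → u ≢ v →
      adj R u v ≡ true
    N*-clique {u = u} {v} w-vertex u∈N* v∈N* u≢v =
      ∧-intro (cong not (⌊⌋≡false (u Fin.≟ v) u≢v))
        (∧-intro (N*-vertex w-vertex u∈N*)
          (∧-intro v-vertex (≈0⇒isZeroᵇ (coLocal-annihilates-vertex (∧-elimˡ u∈N*) v-vertex))))
      where v-vertex = N*-vertex w-vertex v∈N*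

    N*-outside-alliance : ∀ {S} → IsGOA R S → count (λ u → N* u ∧ not (S u)) ≤ card R S
    N*-outside-alliance {S} (S⊆V , (w , w∈S) , offensive)
      with count≡0⊎witness (λ u → N* u ∧ not (S u))
    ... | inj₁ none = subst (_≤ card R S) (sym none) z≤n
    ... | inj₂ (v , v∈N*∖S) = begin
        count (λ u → N* u ∧ not (S u))  ≤⟨ count-except _ _ v neighbour ⟩
        suc (δ-out R S v)               ≡⟨ ℕₚ.+-comm 1 _ ⟩
        δ-out R S v ℕ.+ 1               ≤⟨ offensive v v-vertex v∉S ⟩
        δ-in R S v                      ≤⟨ count-mono (λ u → ∧-elimˡ ∘ ∧-elimʳ {isVertex R u}) ⟩
        card R S                        ∎
      where
      open ≤-Reasoning
      w-vertex = S⊆V w w∈S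
      v∈N* = ∧-elimˡ {N* v} v∈N*∖S
      v∉S = not-injective (∧-elimʳ {N* v} v∈N*∖S)
      v-vertex = N*-vertex w-vertex v∈N*
      neighbour : ∀ u → N* u ∧ not (S u) ≡ true → u ≢ v →
        isVertex R u ∧ not (S u) ∧ adj R v u ≡ true
      neighbour u u∈N*∖S u≢v =
        ∧-intro (N*-vertex w-vertex u∈N*) (∧-intro u∉S (N*-clique w-vertex v∈N* u∈N* (u≢v ∘ sym)))
        where
        u∈N* = ∧-elimˡ {N* u} u∈N*∖S
        u∉S = ∧-elimʳ {N* u} u∈N*∖S

    cardNStar≤2card : ∀ {S} → IsGOA R S → cardNStar R N ≤ card R S ℕ.+ card R S
    cardNStar≤2card {S} alliance = begin
      cardNStar R N
        ≡⟨ count-partition N* S ⟩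
      count (λ u → N* u ∧ S u) ℕ.+ count (λ u → N* u ∧ not (S u))
        ≤⟨ +-mono-≤ (count-mono (λ u → ∧-elimʳ {N* u})) (N*-outside-alliance alliance) ⟩
      card R S ℕ.+ card R S
        ∎
      where open ≤-Reasoning

module ℤ₉-Example where
  open FiniteCommRing ℤ₉ using (_≈_; _≈?_; 0#; *-congˡ; elem-surj)
  open ZeroDivisorGraph ℤ₉ using (proper-ideal⇒non-unit; isGOA?)
  open Data.Nat using (_%_)
  open ≡-Reasoning

  3∣ᵇ_ : ℕ → Bool
  3∣ᵇ n = ⌊ n % 3 ℕ.≟ 0 ⌋

  3∣ᵇ⇒%3≡0 : ∀ n → 3∣ᵇ n ≡ true → n % 3 ≡ 0
  3∣ᵇ⇒%3≡0 n = ⌊⌋≡true⇒ (n % 3 ℕ.≟ 0)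

  %3≡0⇒3∣ᵇ : ∀ n → n % 3 ≡ 0 → 3∣ᵇ n ≡ true
  %3≡0⇒3∣ᵇ n = ⌊⌋≡true (n % 3 ℕ.≟ 0)

  %3-resp-≈ : ∀ {x y} → x ≈ y → x % 3 ≡ y % 3
  %3-resp-≈ {x} {y} x≈y = begin
    x % 3      ≡⟨ m∣n⇒o%n%m≡o%m 3 9 x (divides 3 refl) ⟨
    x % 9 % 3  ≡⟨ cong (_% 3) x≈y ⟩
    y % 9 % 3  ≡⟨ m∣n⇒o%n%m≡o%m 3 9 y (divides 3 refl) ⟩
    y % 3      ∎

  3∣ᵇ-+ : ∀ x y → 3∣ᵇ x ≡ true → 3∣ᵇ y ≡ true → 3∣ᵇ (x ℕ.+ y) ≡ true
  3∣ᵇ-+ x y 3∣x 3∣y = %3≡0⇒3∣ᵇ (x ℕ.+ y) (begin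
    (x ℕ.+ y) % 3          ≡⟨ %-distribˡ-+ x y 3 ⟩
    (x % 3 ℕ.+ y % 3) % 3  ≡⟨ cong₂ (λ a b → (a ℕ.+ b) % 3) (3∣ᵇ⇒%3≡0 x 3∣x) (3∣ᵇ⇒%3≡0 y 3∣y) ⟩
    0                      ∎)

  3∣ᵇ-* : ∀ r x → 3∣ᵇ x ≡ true → 3∣ᵇ (r ℕ.* x) ≡ true
  3∣ᵇ-* r x 3∣x = %3≡0⇒3∣ᵇ (r ℕ.* x) (begin
    (r ℕ.* x) % 3            ≡⟨ %-distribˡ-* r x 3 ⟩
    (r % 3 ℕ.* (x % 3)) % 3  ≡⟨ cong (λ a → (r % 3 ℕ.* a) % 3) (3∣ᵇ⇒%3≡0 x 3∣x) ⟩
    (r % 3 ℕ.* 0) % 3        ≡⟨ cong (_% 3) (*-zeroʳ (r % 3)) ⟩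
    0                        ∎)

  multiplesOf3 : Ideal ℤ₉
  multiplesOf3 = record
    { mem      = 3∣ᵇ_
    ; mem-resp = λ {x} {y} x≈y → cong (λ r → ⌊ r ℕ.≟ 0 ⌋) (%3-resp-≈ {x} {y} x≈y)
    ; mem-0    = refl
    ; mem-+    = 3∣ᵇ-+
    ; mem-neg  = 3∣ᵇ-* 8
    ; mem-*    = 3∣ᵇ-*
    }

  nonzero-divides-multiple-of-3 : ∀ (i j : Fin 9) → ¬ toℕ i ≈ 0# → toℕ j % 3 ≡ 0 →
    ∃ λ (c : Fin 9) → toℕ c ℕ.* toℕ i ≈ toℕ j
  nonzero-divides-multiple-of-3 = from-yes
    (all? λ (i : Fin 9) → all? λ (j : Fin 9) →
      ¬? (toℕ i ≈? 0#) →-dec (toℕ j % 3 ℕ.≟ 0)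
        →-dec any? λ (c : Fin 9) → (toℕ c ℕ.* toℕ i) ≈? toℕ j)

  multiplesOf3-⊆ : ∀ {I} → NonTrivial ℤ₉ I → ∀ y → mem multiplesOf3 y ≡ true → mem I y ≡ true
  multiplesOf3-⊆ {I} (x , x∈I , x≉0) y 3∣y with elem-surj x | elem-surj y
  ... | i , i≈x | j , j≈y
    with nonzero-divides-multiple-of-3 i j (λ i≈0 → x≉0 (trans (sym i≈x) i≈0))
           (trans (%3-resp-≈ {toℕ j} {y} j≈y) (3∣ᵇ⇒%3≡0 y 3∣y))
  ... | c , ci≈j = trans (mem-resp I y≈cx) (mem-* I (toℕ c) x x∈I)
    where
    y≈cx : y ≈ toℕ c ℕ.* x
    y≈cx = begin
      y % 9                    ≡⟨ j≈y ⟨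
      toℕ j % 9                ≡⟨ ci≈j ⟨
      (toℕ c ℕ.* toℕ i) % 9    ≡⟨ *-congˡ {toℕ c} {toℕ i} {x} i≈x ⟩
      (toℕ c ℕ.* x) % 9        ∎

  multiplesOf3-proper : Proper ℤ₉ multiplesOf3
  multiplesOf3-proper = 1 , refl

  multiplesOf3-coLocal : IsCoLocalIdeal ℤ₉ multiplesOf3
  multiplesOf3-coLocal = (3 , refl , λ ()) , λ I I-nonTrivial _ → multiplesOf3-⊆ {I} I-nonTrivial

  coLocal≗multiplesOf3 : ∀ {N} → IsCoLocalIdeal ℤ₉ N → ∀ x → mem N x ≡ mem multiplesOf3 x
  coLocal≗multiplesOf3 {N} (N-nonTrivial , N-least) x = ⇔→≡ (mk⇔
    (N-least multiplesOf3 (proj₁ multiplesOf3-coLocal) multiplesOf3-proper x)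
    (multiplesOf3-⊆ {N} N-nonTrivial x))

  coLocal-cardNStar : ∀ {N} → IsCoLocalIdeal ℤ₉ N → cardNStar ℤ₉ N ≡ 2
  coLocal-cardNStar {N} N-coLocal = begin
    cardNStar ℤ₉ N             ≡⟨ count-cong {9} (λ i → cong (_∧ not (isZeroᵇ ℤ₉ (toℕ i)))
                                    (coLocal≗multiplesOf3 {N} N-coLocal (toℕ i))) ⟩
    cardNStar ℤ₉ multiplesOf3  ≡⟨⟩
    2                          ∎

  not-field : ¬ IsField ℤ₉
  not-field (_ , inverse) =
    proper-ideal⇒non-unit {multiplesOf3} {3} multiplesOf3-proper refl (inverse 3 λ ())

  singleton3 : VSet ℤ₉
  singleton3 i = ⌊ i Fin.≟ # 3 ⌋

  γᵒ≡1 : IsGammaO ℤ₉ 1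
  γᵒ≡1 = (singleton3 , from-yes (isGOA? singleton3) , refl)
       , λ S (_ , (i , i∈S) , _) → count-witness≥1 S i i∈S

theorem2p7 : ∀ {c ℓ : Level}
    → ((R : FiniteCommRing c ℓ) → ¬ IsField R
        → (N : Ideal R) → IsCoLocalIdeal R N
        → (S : VSet R) → IsGOA R S → ⌈ cardNStar R N /2⌉ ≤ card R S)
    × (¬ IsField ℤ₉ × IsCoLocal ℤ₉
        × ((N : Ideal ℤ₉) → IsCoLocalIdeal ℤ₉ N → IsGammaO ℤ₉ ⌈ cardNStar ℤ₉ N /2⌉))
theorem2p7 =
    (λ R _ N N-coLocal S alliance →
       ⌈/2⌉≤ (ZeroDivisorGraph.cardNStar≤2card R {N} N-coLocal alliance))
  , not-field
  , (multiplesOf3 , multiplesOf3-coLocal)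
  , λ N N-coLocal → subst (λ n → IsGammaO ℤ₉ ⌈ n /2⌉) (sym (coLocal-cardNStar {N} N-coLocal)) γᵒ≡1
  where open ℤ₉-Example
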